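{- Let $M$ be a tropical oriented matroid with parameters $(n,d)$ in general position, let $\mathcal I=(I_1,\dots,I_n)$ be an $(n,d)$-halfspace system and let $\mathcal A'\subseteq[n]$. Let $\mathcal L=\mathcal L(\mathcal A',\mathcal I)=\{\mathcal T_{\mathcal I}(C): C\in M\}\subseteq\{+,-,0\}^{\mathcal A'}$. Then either the all-zero vector does not belong to $\mathcal L$, or $\mathcal L=\{+,-,0\}^{\mathcal A'}$ (so that $(\mathcal L,\mathcal A')$ is the oriented matroid whose covectors are all of $\{+,-,0\}^{\mathcal A'}$).
   Context: An $(n,d)$-type is an $n$-tuple $A=(A_1,\dots,A_n)$ of nonempty subsets of $[d]$; $K_A$ is the bipartite graph on $N_1,\dots,N_n,D_1,\dots,D_d$ with edges $N_iD_j$, $j\in A_i$. Refinement by an ordered partition $P=(P_1,\dots,P_k)$ of $[d]$: entries $A_i\cap P_{m(i)}$ with $m(i)$ minimal such that this is nonempty. Comparability graph $CG_{A,B}$: multigraph on $[d]$ with, for each $i$ and $j\in A_i$, $k\in B_i$, $j\ne k$, an edge $jk$, undirected if $j,k\in A_i\cap B_i$, otherwise directed $j\to k$; acyclic means no closed walk using some directed edge and all directed edges forwards. A tropical oriented matroid with parameters $(n,d)$ is a set $M$ of $(n,d)$-types satisfying Boundary ($(\{j\},\dots,\{j\})\in M$), Comparability ($CG_{A,B}$ acyclic), Elimination (for $A,B\in M$, $j\in[n]$ there is $C\in M$ with $C_j=A_j\cup B_j$, $C_k\in\{A_k,B_k,A_k\cup B_k\}$) and Surrounding (closed under refinement). $M$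 is in general position if every $K_A$, $A\in M$, is a forest. An $(n,d)$-halfspace system is $\mathcal I=(I_1,\dots,I_n)$ with $\emptyset\ne I_i\subsetneq[d]$. For $C\in M$, $\mathcal T_{\mathcal I}(C)\in\{+,-,0\}^{\mathcal A'}$ has $i$-th coordinate ($i\in\mathcal A'$) equal to $+$ if $C_i\subseteq I_i$, $-$ if $C_i\subseteq[d]\setminus I_i$, and $0$ otherwise. -}

module Defs where

open import Data.Nat using (ℕ; suc; _≤_)
open import Data.Fin using (Fin; _≟_)
open import Data.Fin.Subset using (Subset; _∈_; _∉_; _∩_; _∪_; _⊆_; ∁; ⊤; ⁅_⁆; Nonempty; Empty)
open import Data.Fin.Subset.Properties using (nonempty?; _⊆?_)
open import Data.Vec using (Vec; lookup; replicate; map)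
open import Data.List using (List; []; _∷_; length; _∷ʳ_)
open import Data.List.Membership.Propositional using () renaming (_∈_ to _∈ˡ_)
open import Data.List.Relation.Unary.All using (All)
open import Data.List.Relation.Unary.Any using (Any)
open import Data.List.Relation.Unary.AllPairs using (AllPairs)
open import Data.List.Relation.Unary.Linked using (Linked)
open import Data.List.Relation.Unary.Unique.Propositional using (Unique)
open import Data.Product using (Σ; ∃; _×_; _,_)
open import Data.Sum using (_⊎_; inj₁; inj₂)
open import Data.Bool using (if_then_else_)
open import Relation.Nullary using (¬_; does)
open import Relation.Binary.PropositionalEquality using (_≡_; _≢_)
open import Relation.Binary.Construct.Closure.ReflexiveTransitive using (Star)

Ty : ℕ → ℕ → Set
Ty n d = Vec (Subset d) n

IsType : ∀ {n d} → Ty n d → Set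
IsType {n} A = ∀ (i : Fin n) → Nonempty (lookup A i)

record OrderedPartition (d : ℕ) : Set where
  field
    blocks   : List (Subset d)
    nonempty : All Nonempty blocks
    disjoint : AllPairs (λ P Q → Empty (P ∩ Q)) blocks
    covers   : ∀ (x : Fin d) → Any (x ∈_) blocks

-- A_i ∩ P_m with m minimal such that this is nonempty
-- (the fallback for an exhausted list never occurs for a partition
-- and a nonempty A_i).
refineEntry : ∀ {d} → List (Subset d) → Subset d → Subset d
refineEntry []       a = a
refineEntry (P ∷ Ps) a =
  if does (nonempty? (a ∩ P)) then a ∩ P else refineEntry Ps a

refine : ∀ {n d} → OrderedPartition d → Ty n d → Ty n d
refine P A = map (refineEntry (OrderedPartition.blocks P)) A

UndirEdge : ∀ {n d} → Ty n d → Ty n d → Fin n → Fin d → Fin d → Set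
UndirEdge A B i j k =
  j ∈ lookup A i × k ∈ lookup B i × j ≢ k ×
  j ∈ (lookup A i ∩ lookup B i) × k ∈ (lookup A i ∩ lookup B i)

DirEdge : ∀ {n d} → Ty n d → Ty n d → Fin n → Fin d → Fin d → Set
DirEdge A B i j k =
  j ∈ lookup A i × k ∈ lookup B i × j ≢ k ×
  ¬ (j ∈ (lookup A i ∩ lookup B i) × k ∈ (lookup A i ∩ lookup B i))

Step : ∀ {n d} → Ty n d → Ty n d → Fin d → Fin d → Set
Step A B j k =
  ∃ λ i → UndirEdge A B i j k ⊎ UndirEdge A B i k j ⊎ DirEdge A B i j k

-- acyclic: no closed walk that uses some directed edge (j → k)
-- and traverses all directed edges forwards
CGAcyclic : ∀ {n d} → Ty n d → Ty n d → Set
CGAcyclic A B =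
  ∀ i j k → DirEdge A B i j k → ¬ Star (Step A B) k j

record IsTOM (n d : ℕ) (M : List (Ty n d)) : Set where
  field
    types         : ∀ A → A ∈ˡ M → IsType A
    boundary      : ∀ (j : Fin d) → replicate n ⁅ j ⁆ ∈ˡ M
    comparability : ∀ A B → A ∈ˡ M → B ∈ˡ M → CGAcyclic A B
    elimination   : ∀ A B → A ∈ˡ M → B ∈ˡ M → ∀ (j : Fin n) →
                    ∃ λ C → C ∈ˡ M ×
                      lookup C j ≡ lookup A j ∪ lookup B j ×
                      (∀ (k : Fin n) → lookup C k ≡ lookup A k
                                      ⊎ lookup C k ≡ lookup B k
                                      ⊎ lookup C k ≡ lookup A k ∪ lookup B k)
    surrounding   : ∀ A → A ∈ˡ M → ∀ (P : OrderedPartition d) →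
                    refine P A ∈ˡ M

-- vertices N_i (inj₁ i) and D_j (inj₂ j) of K_A
Vertex : ℕ → ℕ → Set
Vertex n d = Fin n ⊎ Fin d

data Adj {n d} (A : Ty n d) : Vertex n d → Vertex n d → Set where
  nd : ∀ i j → j ∈ lookup A i → Adj A (inj₁ i) (inj₂ j)
  dn : ∀ i j → j ∈ lookup A i → Adj A (inj₂ j) (inj₁ i)

HasCycle : ∀ {n d} → Ty n d → Set
HasCycle {n} {d} A =
  ∃ λ (v : Vertex n d) → ∃ λ (vs : List (Vertex n d)) →
    2 ≤ length vs × Unique (v ∷ vs) × Linked (Adj A) ((v ∷ vs) ∷ʳ v)

Forest : ∀ {n d} → Ty n d → Set
Forest A = ¬ HasCycle A

GeneralPosition : ∀ {n d} → List (Ty n d) → Set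
GeneralPosition M = ∀ A → A ∈ˡ M → Forest A

IsHalfspaceSystem : ∀ {n d} → Vec (Subset d) n → Set
IsHalfspaceSystem {n} I =
  ∀ (i : Fin n) → Nonempty (lookup I i) × lookup I i ≢ ⊤

data Sign : Set where
  plus minus zero : Sign

sign : ∀ {d} → Subset d → Subset d → Sign
sign c I =
  if does (c ⊆? I) then plus
  else if does (c ⊆? ∁ I) then minus
  else zero

T : ∀ {n d} → Vec (Subset d) n → Ty n d → Fin n → Sign
T I C i = sign (lookup C i) (lookup I i)

SignVec : ∀ {n} → Subset n → Set
SignVec {n} A' = (i : Fin n) → i ∈ A' → Sign

InL : ∀ {n d} → List (Ty n d) → Vec (Subset d) n → (A' : Subset n) →
      SignVec A' → Set
InL M I A' X = ∃ λ C → C ∈ˡ M × (∀ i (p : i ∈ A') → T I C i ≡ X i p)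

zeroVec : ∀ {n} (A' : Subset n) → SignVec A'
zeroVec A' i p = zero

module Submission where

-- Proposition 5.6.  Let C ∈ M have T_I(C) = 0 on A': each C_i (i ∈ A')
-- meets both I_i and its complement.  For a sign vector X pick nonempty
-- targets t_i ⊆ C_i with sign(t_i, I_i) = X_i (a point of C_i ∩ I_i, a point
-- of C_i ∖ I_i, or both) and a rank function r : [d] → ℕ whose minimal
-- elements on every C_i are exactly t_i.  Refining C by the ordered
-- partition of [d] into level sets of r gives a type in M (Surrounding)
-- with T_I = X.  Such an r exists because K_C is a forest: if every index of
-- a list J had two elements of C_i lying in other C_j (j ∈ J), a
-- non-backtracking walk in K_C would close a cycle; so some i ∈ J is a leaf,
-- and after realising the targets of J ∖ {i} we re-rank C_i around its at
-- most one shared element.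

open import Defs
open import Level using (0ℓ)
open import Data.Bool using (true; if_then_else_)
open import Data.Empty using (⊥-elim)
open import Data.Nat as ℕ using (ℕ; zero; suc; _≤_; _<_; _+_; z≤n; s≤s)
open import Data.Nat.Properties
  using (≤-refl; ≤-reflexive; ≤-antisym; ≤-pred; <⇒≤; <⇒≱; <-irrefl; ≤∧≢⇒<;
         +-suc; +-identityʳ; n<1+n)
open import Data.Nat.Induction using (<-wellFounded)
open import Data.Fin as Fin using (Fin)
open import Data.Fin.Properties using (any?; all?)
open import Data.Fin.Subset
  using (Subset; _∈_; _∉_; _∩_; _∪_; _⊆_; ∁; ⁅_⁆; Nonempty; Empty)
open import Data.Fin.Subset.Properties
  using (_∈?_; _⊆?_; nonempty?; ⊆-antisym; x∈⁅x⁆; x∈⁅y⁆⇒x≡y; x∈p∩q⁺; x∈p∩q⁻;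
         x∈p∪q⁺; x∈p∪q⁻; x∉∁p⇒x∈p; x∉p⇒x∈∁p; x∈p⇒x∉∁p)
open import Data.Vec using (Vec; lookup; tabulate)
open import Data.Vec.Properties using (lookup-map; lookup∘tabulate; lookup⇒[]=; []=⇒lookup)
open import Data.Vec.Properties.WithK using ([]=-irrelevant)
open import Data.List using (List; []; _∷_; _++_; _∷ʳ_; length; filter; map; allFin)
open import Data.List.Properties using (filter-notAll)
open import Data.List.Extrema.Nat using (max; v<max⁺)
open import Data.List.Membership.Propositional using (find; lose)
  renaming (_∈_ to _∈ˡ_; _∉_ to _∉ˡ_)
import Data.List.Membership.DecPropositional as DecMembership
open import Data.List.Membership.Propositional.Properties
  using (∈-filter⁺; ∈-filter⁻; ∈-allFin; ∈-map⁺; ∈-++⁺ˡ; ∈-++⁺ʳ; ∈-∃++)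
open import Data.List.Relation.Unary.All as All using (All; []; _∷_)
open import Data.List.Relation.Unary.All.Properties
  using (all-filter; ¬All⇒Any¬; ¬Any⇒All¬; ∷ʳ⁺; ++⁻ˡ; ++⁻ʳ)
open import Data.List.Relation.Unary.Any as Any using (Any; here; there)
import Data.List.Relation.Unary.Any.Properties as Any
open import Data.List.Relation.Unary.AllPairs using (AllPairs; []; _∷_)
import Data.List.Relation.Unary.AllPairs.Properties as AllPairs
open import Data.List.Relation.Unary.Linked using (Linked; []; [-]; _∷_)
open import Data.List.Relation.Unary.Unique.Propositional using (Unique)
open import Data.Product using (∃; ∃₂; _×_; _,_; proj₁; proj₂)
open import Data.Sum using (_⊎_; inj₁; inj₂; [_,_])
import Data.Sum as Sum
open import Data.Sum.Properties using (≡-dec; inj₁-injective; inj₂-injective)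
open import Function using (_∘_; id; _⇔_; mk⇔; Equivalence)
open import Function.Properties.Equivalence using () renaming (sym to ⇔-sym; trans to ⇔-trans)
open import Induction.WellFounded using (Acc; acc)
open import Relation.Binary using (Rel; DecidableEquality)
open import Relation.Binary.PropositionalEquality
  using (_≡_; _≢_; refl; sym; trans; cong; subst; subst₂; module ≡-Reasoning)
open import Relation.Nullary using (¬_; Dec; yes; no; does; ¬?)
open import Relation.Nullary.Decidable
  using (dec-true; dec-false; dec-yes-irr; decidable-stable; map′; _×-dec_; _→-dec_)
open import Relation.Unary using (Decidable)

open Equivalence using (to; from)

if-yes : ∀ {P A : Set} (p? : Dec P) {a b : A} → P → (if does p? then a else b) ≡ a
if-yes p? p rewrite dec-true p? p = refl

if-no : ∀ {P A : Set} (p? : Dec P) {a b : A} → ¬ P → (if does p? then a else b) ≡ b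
if-no p? ¬p rewrite dec-false p? ¬p = refl

does-sound : ∀ {P : Set} (p? : Dec P) → does p? ≡ true → P
does-sound (yes p) _ = p
does-sound (no _) ()

one-avoids : ∀ {V : Set} → DecidableEquality V → {a b : V} → a ≢ b → ∀ u → a ≢ u ⊎ b ≢ u
one-avoids _≟_ {a} a≢b u with a ≟ u
... | yes refl = inj₂ (λ b≡a → a≢b (sym b≡a))
... | no a≢u = inj₁ a≢u

module _ {d : ℕ} {c I : Subset d} where

  sign-plus : c ⊆ I → sign c I ≡ plus
  sign-plus c⊆I = if-yes (c ⊆? I) c⊆I

  sign-minus : ¬ c ⊆ I → c ⊆ ∁ I → sign c I ≡ minus
  sign-minus c⊈I c⊆∁I = trans (if-no (c ⊆? I) c⊈I) (if-yes (c ⊆? ∁ I) c⊆∁I)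

  sign-zero : ¬ c ⊆ I → ¬ c ⊆ ∁ I → sign c I ≡ zero
  sign-zero c⊈I c⊈∁I = trans (if-no (c ⊆? I) c⊈I) (if-no (c ⊆? ∁ I) c⊈∁I)

  sign-zero⁻ : sign c I ≡ zero → ¬ c ⊆ I × ¬ c ⊆ ∁ I
  sign-zero⁻ eq with c ⊆? I | c ⊆? ∁ I
  sign-zero⁻ () | yes _ | _
  sign-zero⁻ () | no _ | yes _
  sign-zero⁻ _ | no c⊈I | no c⊈∁I = c⊈I , c⊈∁I

  ⊈-witness : ¬ c ⊆ I → ∃ λ x → x ∈ c × x ∉ I
  ⊈-witness c⊈I with any? (λ x → (x ∈? c) ×-dec ¬? (x ∈? I))
  ... | yes witness = witness
  ... | no none = ⊥-elim (c⊈I λ {x} x∈c →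
                    decidable-stable (x ∈? I) (λ x∉I → none (x , x∈c , x∉I)))

⁅⁆-⊆ : ∀ {d} {a : Fin d} {c : Subset d} → a ∈ c → ⁅ a ⁆ ⊆ c
⁅⁆-⊆ {a = a} a∈c x∈⁅a⁆ rewrite x∈⁅y⁆⇒x≡y a x∈⁅a⁆ = a∈c

-- A set of sign zero w.r.t. I meets I and its complement, so it has
-- nonempty subsets of every sign: ⁅a⁆, ⁅b⁆ or ⁅a⁆ ∪ ⁅b⁆.
subset-of-sign : ∀ {d} {c I : Subset d} → sign c I ≡ zero →
                 ∀ σ → ∃ λ t → t ⊆ c × Nonempty t × sign t I ≡ σ
subset-of-sign {c = c} {I} sign≡0 σ with sign-zero⁻ sign≡0
... | c⊈I , c⊈∁I with ⊈-witness c⊈∁I | ⊈-witness c⊈I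
...   | a , a∈c , a∉∁I | b , b∈c , b∉I = choose σ
  where
  a∈I : a ∈ I
  a∈I = x∉∁p⇒x∈p a∉∁I

  choose : ∀ σ → ∃ λ t → t ⊆ c × Nonempty t × sign t I ≡ σ
  choose plus = ⁅ a ⁆ , ⁅⁆-⊆ a∈c , (a , x∈⁅x⁆ a) , sign-plus (⁅⁆-⊆ a∈I)
  choose minus = ⁅ b ⁆ , ⁅⁆-⊆ b∈c , (b , x∈⁅x⁆ b) ,
    sign-minus (λ ⊆I → b∉I (⊆I (x∈⁅x⁆ b))) (⁅⁆-⊆ (x∉p⇒x∈∁p b∉I))
  choose zero = ⁅ a ⁆ ∪ ⁅ b ⁆ ,
    (λ x∈ → [ ⁅⁆-⊆ a∈c , ⁅⁆-⊆ b∈c ] (x∈p∪q⁻ _ _ x∈)) , (a , x∈p∪q⁺ (inj₁ (x∈⁅x⁆ a))) ,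
    sign-zero (λ ⊆I → b∉I (⊆I (x∈p∪q⁺ (inj₂ (x∈⁅x⁆ b)))))
              (λ ⊆∁I → x∈p⇒x∉∁p a∈I (⊆∁I (x∈p∪q⁺ (inj₁ (x∈⁅x⁆ a)))))

Minimal : ∀ {d} → (Fin d → ℕ) → Subset d → Fin d → Set
Minimal r c x = x ∈ c × (∀ y → y ∈ c → r x ≤ r y)

minimal-shift : ∀ {d} {r r′ : Fin d → ℕ} {c : Subset d} →
                (∀ {x} → x ∈ c → r′ x ≡ suc (r x)) → ∀ x → Minimal r c x ⇔ Minimal r′ c x
minimal-shift shift x = mk⇔
  (λ (x∈c , min) → x∈c , λ y y∈c →
     subst₂ _≤_ (sym (shift x∈c)) (sym (shift y∈c)) (s≤s (min y y∈c)))
  (λ (x∈c , min) → x∈c , λ y y∈c →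
     ≤-pred (subst₂ _≤_ (shift x∈c) (shift y∈c) (min y y∈c)))

-- There is a rank function r′ agreeing with suc ∘ r on S whose
-- minimal elements on c are exactly t: t gets the rank of the shared
-- element (if it lies in t) or 0, the rest of c gets something larger.
module _ {d : ℕ} (r : Fin d → ℕ) {S : Fin d → Set} (S? : Decidable S) {c t : Subset d}
         (t⊆c : t ⊆ c) (t≠∅ : Nonempty t)
         (atMostOne : ∀ {x y} → x ∈ c → S x → y ∈ c → S y → x ≡ y) where

  private
    targetRank : Dec (∃ λ s → s ∈ t × S s) → ℕ
    targetRank (yes (s , _)) = suc (r s)
    targetRank (no _) = 0

    ℓ : ℕ
    ℓ = targetRank (any? λ s → (s ∈? t) ×-dec S? s)

    r′ : Fin d → ℕ
    r′ x = if does (S? x) then suc (r x) else if does (x ∈? t) then ℓ else suc ℓ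

    targetRank-shared : ∀ {x} dec → x ∈ t → S x → targetRank dec ≡ suc (r x)
    targetRank-shared (yes (s , s∈t , Ss)) x∈t Sx =
      cong (suc ∘ r) (atMostOne (t⊆c s∈t) Ss (t⊆c x∈t) Sx)
    targetRank-shared (no none) x∈t Sx = ⊥-elim (none (_ , x∈t , Sx))

    targetRank-unshared : ∀ {x} dec → x ∈ c → x ∉ t → S x → targetRank dec ≡ 0
    targetRank-unshared (yes (s , s∈t , Ss)) x∈c x∉t Sx =
      ⊥-elim (x∉t (subst (_∈ t) (atMostOne (t⊆c s∈t) Ss x∈c Sx) s∈t))
    targetRank-unshared (no _) _ _ _ = refl

    r′-shared : ∀ {x} → S x → r′ x ≡ suc (r x)
    r′-shared {x} Sx = if-yes (S? x) Sx

    r′-target : ∀ {x} → x ∈ t → r′ x ≡ ℓ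
    r′-target {x} x∈t with S? x
    ... | yes Sx = sym (targetRank-shared _ x∈t Sx)
    ... | no _ = if-yes (x ∈? t) x∈t

    r′-above : ∀ {x} → x ∈ c → x ∉ t → ℓ < r′ x
    r′-above {x} x∈c x∉t with S? x
    ... | yes Sx = subst (_< suc (r x)) (sym (targetRank-unshared _ x∈c x∉t Sx)) (s≤s z≤n)
    ... | no _ = subst (ℓ <_) (sym (if-no (x ∈? t) x∉t)) (n<1+n ℓ)

    ℓ≤r′ : ∀ {y} → y ∈ c → ℓ ≤ r′ y
    ℓ≤r′ {y} y∈c = by-cases (y ∈? t)
      where
      by-cases : Dec (y ∈ t) → ℓ ≤ r′ y
      by-cases (yes y∈t) = ≤-reflexive (sym (r′-target y∈t))
      by-cases (no y∉t) = <⇒≤ (r′-above y∈c y∉t)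

    minimal⇔target : ∀ x → Minimal r′ c x ⇔ x ∈ t
    minimal⇔target x = mk⇔ minimal⇒target
      (λ x∈t → t⊆c x∈t , λ y y∈c → subst (_≤ r′ y) (sym (r′-target x∈t)) (ℓ≤r′ y∈c))
      where
      minimal⇒target : Minimal r′ c x → x ∈ t
      minimal⇒target (x∈c , min) = decidable-stable (x ∈? t) λ x∉t →
        <⇒≱ (r′-above x∈c x∉t) (subst (r′ x ≤_) (r′-target (proj₂ t≠∅)) (min _ (t⊆c (proj₂ t≠∅))))

  rerank : ∃ λ r′ → (∀ {x} → S x → r′ x ≡ suc (r x)) × (∀ x → Minimal r′ c x ⇔ x ∈ t)
  rerank = r′ , r′-shared , minimal⇔target

module RankPartition {d : ℕ} (r : Fin d → ℕ) where

  level : ℕ → Subset d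
  level k = tabulate (λ x → does (r x ℕ.≟ k))

  ∈-level⁺ : ∀ {x k} → r x ≡ k → x ∈ level k
  ∈-level⁺ {x} {k} rx≡k =
    lookup⇒[]= x (level k) (trans (lookup∘tabulate _ x) (dec-true (r x ℕ.≟ k) rx≡k))

  ∈-level⁻ : ∀ {x k} → x ∈ level k → r x ≡ k
  ∈-level⁻ {x} {k} x∈ =
    does-sound (r x ℕ.≟ k) (trans (sym (lookup∘tabulate _ x)) ([]=⇒lookup x∈))

  levelsFrom : ℕ → ℕ → List (Subset d)
  levelsFrom k zero = []
  levelsFrom k (suc m) = level k ∷ levelsFrom (suc k) m

  levelsFrom-above : ∀ k m → All (λ Q → ∀ {x} → x ∈ Q → k ≤ r x) (levelsFrom k m)
  levelsFrom-above k zero = []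
  levelsFrom-above k (suc m) =
    (λ x∈ → ≤-reflexive (sym (∈-level⁻ x∈))) ∷
    All.map (λ above {x} x∈ → <⇒≤ (above x∈)) (levelsFrom-above (suc k) m)

  levelsFrom-disjoint : ∀ k m → AllPairs (λ P Q → Empty (P ∩ Q)) (levelsFrom k m)
  levelsFrom-disjoint k zero = []
  levelsFrom-disjoint k (suc m) =
    All.map disjoint (levelsFrom-above (suc k) m) ∷ levelsFrom-disjoint (suc k) m
    where
    disjoint : ∀ {Q} → (∀ {x} → x ∈ Q → suc k ≤ r x) → Empty (level k ∩ Q)
    disjoint above (x , x∈) =
      <-irrefl (sym (∈-level⁻ (proj₁ (x∈p∩q⁻ _ _ x∈)))) (above (proj₂ (x∈p∩q⁻ _ _ x∈)))

  level-∈-levelsFrom : ∀ {k j} m → k ≤ j → j < k + m → level j ∈ˡ levelsFrom k m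
  level-∈-levelsFrom {k} zero k≤j j<k+0 =
    ⊥-elim (<⇒≱ j<k+0 (subst (_≤ _) (sym (+-identityʳ k)) k≤j))
  level-∈-levelsFrom {k} {j} (suc m) k≤j j<k+m with k ℕ.≟ j
  ... | yes refl = here refl
  ... | no k≢j =
    there (level-∈-levelsFrom m (≤∧≢⇒< k≤j k≢j) (subst (j <_) (+-suc k m) j<k+m))

  refineEntry-levelsFrom : ∀ k m {c} → (∀ {y} → y ∈ c → k ≤ r y) →
                           (∀ {y} → y ∈ c → r y < k + m) → Nonempty c →
                           ∀ x → x ∈ refineEntry (levelsFrom k m) c ⇔ Minimal r c x
  refineEntry-levelsFrom k zero above below (y , y∈c) x =
    ⊥-elim (<⇒≱ (below y∈c) (subst (_≤ r y) (sym (+-identityʳ k)) (above y∈c)))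
  refineEntry-levelsFrom k (suc m) {c} above below c≠∅ x with nonempty? (c ∩ level k)
  ... | yes (z , z∈) = mk⇔
    (λ x∈ → let (x∈c , x∈k) = x∈p∩q⁻ c _ x∈ in
       x∈c , λ y y∈c → subst (_≤ r y) (sym (∈-level⁻ x∈k)) (above y∈c))
    (λ (x∈c , min) → let (z∈c , z∈k) = x∈p∩q⁻ c _ z∈ in
       x∈p∩q⁺ (x∈c , ∈-level⁺
         (≤-antisym (subst (r x ≤_) (∈-level⁻ z∈k) (min _ z∈c)) (above x∈c))))
  ... | no c∩k=∅ = refineEntry-levelsFrom (suc k) m above′ below′ c≠∅ x
    where
    above′ : ∀ {y} → y ∈ c → suc k ≤ r y
    above′ y∈c = ≤∧≢⇒< (above y∈c) (λ k≡ry → c∩k=∅ (_ , x∈p∩q⁺ (y∈c , ∈-level⁺ (sym k≡ry))))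
    below′ : ∀ {y} → y ∈ c → r y < suc k + m
    below′ {y} y∈c = subst (r y <_) (+-suc k m) (below y∈c)

  refineEntry-filter : ∀ (Ps : List (Subset d)) c →
                       refineEntry (filter nonempty? Ps) c ≡ refineEntry Ps c
  refineEntry-filter [] c = refl
  refineEntry-filter (P ∷ Ps) c with nonempty? P
  ... | yes _ =
    cong (λ rest → if does (nonempty? (c ∩ P)) then c ∩ P else rest) (refineEntry-filter Ps c)
  ... | no P=∅ = trans (refineEntry-filter Ps c)
                   (sym (if-no (nonempty? (c ∩ P)) λ (x , x∈) → P=∅ (x , proj₂ (x∈p∩q⁻ c P x∈))))

  bound : ℕ
  bound = max 0 (map (suc ∘ r) (allFin d))

  rank<bound : ∀ x → r x < bound
  rank<bound x = v<max⁺ 0 _ (inj₂ (Any.map⁺ (lose (∈-allFin x) ≤-refl)))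

  rankPartition : OrderedPartition d
  rankPartition = record
    { blocks = filter nonempty? (levelsFrom 0 bound)
    ; nonempty = all-filter nonempty? (levelsFrom 0 bound)
    ; disjoint = AllPairs.filter⁺ nonempty? (levelsFrom-disjoint 0 bound)
    ; covers = λ x → lose (∈-filter⁺ nonempty? (level-∈-levelsFrom bound z≤n (rank<bound x))
                                                (x , ∈-level⁺ refl))
                          (∈-level⁺ refl)
    }

  refine-rankPartition : ∀ {c t} → Nonempty c → (∀ x → Minimal r c x ⇔ x ∈ t) →
                         refineEntry (OrderedPartition.blocks rankPartition) c ≡ t
  refine-rankPartition {c} c≠∅ minimal⇔t =
    ⊆-antisym (λ {x} x∈ → to (minimal⇔t x) (to (refined⇔minimal x) x∈))
              (λ {x} x∈ → from (refined⇔minimal x) (from (minimal⇔t x) x∈))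
    where
    refined⇔minimal : ∀ x →
      x ∈ refineEntry (OrderedPartition.blocks rankPartition) c ⇔ Minimal r c x
    refined⇔minimal x =
      subst (λ e → x ∈ e ⇔ Minimal r c x) (sym (refineEntry-filter (levelsFrom 0 bound) c))
            (refineEntry-levelsFrom 0 bound (λ _ → z≤n) (λ {y} _ → rank<bound y) c≠∅ x)

-- A cycle of an arbitrary relation, in the shape of HasCycle: distinct
-- v, v₁, …, v_m (m ≥ 2), consecutive ones related and v_m related to v.
-- HasCycle A is Cycle (Adj A).
Cycle : {V : Set} → Rel V 0ℓ → Set
Cycle {V} R = ∃ λ (v : V) → ∃ λ (vs : List V) →
  2 ≤ length vs × Unique (v ∷ vs) × Linked R ((v ∷ vs) ∷ʳ v)

module _ {V : Set} {R : Rel V 0ℓ} where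

  linked-close : ∀ (p : List V) {w x q} → Linked R (p ++ w ∷ q) → R w x →
                 Linked R ((p ∷ʳ w) ∷ʳ x)
  linked-close [] _ Rwx = Rwx ∷ [-]
  linked-close (y ∷ []) (Ryw ∷ _) Rwx = Ryw ∷ Rwx ∷ [-]
  linked-close (y ∷ z ∷ p) (Ryz ∷ linked) Rwx = Ryz ∷ linked-close (z ∷ p) linked Rwx

  unique-prefix : ∀ (p : List V) {w q} → Unique (p ++ w ∷ q) → Unique (p ∷ʳ w)
  unique-prefix [] _ = [] ∷ []
  unique-prefix (x ∷ p) (x∉ ∷ unique) =
    ∷ʳ⁺ (++⁻ˡ p x∉) (All.head (++⁻ʳ p x∉)) ∷ unique-prefix p unique

  ∷ʳ-nonempty : ∀ (p : List V) {w} → 1 ≤ length (p ∷ʳ w)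
  ∷ʳ-nonempty [] = s≤s z≤n
  ∷ʳ-nonempty (_ ∷ _) = s≤s z≤n

  close-cycle : ∀ {v u w rest} → Unique (v ∷ u ∷ rest) → Linked R (v ∷ u ∷ rest) →
                R w v → w ∈ˡ rest → Cycle R
  close-cycle {v} {u} {w} unique linked Rwv w∈rest with ∈-∃++ w∈rest
  ... | pre , _ , refl = v , (u ∷ pre) ∷ʳ w , s≤s (∷ʳ-nonempty pre) ,
                         unique-prefix (v ∷ u ∷ pre) unique , linked-close (v ∷ u ∷ pre) linked Rwv

module NonBacktrackingWalk
  {V : Set} (_≟_ : DecidableEquality V)
  (vertices : List V) (complete : ∀ v → v ∈ˡ vertices)
  (R : Rel V 0ℓ) (irreflexive : ∀ {v} → ¬ R v v)
  (P : V → Set) (extend : ∀ {v} → P v → ∀ u → ∃ λ w → P w × R w v × w ≢ u)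
  where

  open DecMembership _≟_ using () renaming (_∈?_ to _∈ˡ?_)

  Covers : List V → List V → Set
  Covers path unvisited = ∀ x → x ∈ˡ path ⊎ x ∈ˡ unvisited

  visit : ∀ {path unvisited} w → Covers path unvisited → w ∉ˡ path →
          ∃ λ unvisited′ → length unvisited′ < length unvisited × Covers (w ∷ path) unvisited′
  visit {path} {unvisited} w covers w∉path =
    filter ≢w? unvisited ,
    filter-notAll ≢w? unvisited (Any.map (λ w≡x x≢w → x≢w (sym w≡x)) w∈unvisited) ,
    covers′
    where
    ≢w? : Decidable (_≢ w)
    ≢w? x = ¬? (x ≟ w)
    w∈unvisited : w ∈ˡ unvisited
    w∈unvisited = [ (λ w∈path → ⊥-elim (w∉path w∈path)) , id ] (covers w)
    covers′ : Covers (w ∷ path) (filter ≢w? unvisited)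
    covers′ x with x ≟ w
    ... | yes x≡w = inj₁ (here x≡w)
    ... | no x≢w = Sum.map there (λ x∈ → ∈-filter⁺ ≢w? x∈ x≢w) (covers x)

  -- The walk is stored newest vertex first.
  walk : ∀ v u rest unvisited → P v → Unique (v ∷ u ∷ rest) → Linked R (v ∷ u ∷ rest) →
         Covers (v ∷ u ∷ rest) unvisited → Acc _<_ (length unvisited) → Cycle R
  walk v u rest unvisited Pv unique linked covers (acc smaller) with extend Pv u
  ... | w , Pw , Rwv , w≢u with w ∈ˡ? (v ∷ u ∷ rest)
  ...   | yes (here refl) = ⊥-elim (irreflexive Rwv)
  ...   | yes (there (here w≡u)) = ⊥-elim (w≢u w≡u)
  ...   | yes (there (there w∈rest)) = close-cycle unique linked Rwv w∈rest
  ...   | no w∉path with visit w covers w∉path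
  ...     | unvisited′ , shorter , covers′ =
    walk w v (u ∷ rest) unvisited′ Pw (¬Any⇒All¬ _ w∉path ∷ unique) (Rwv ∷ linked) covers′
         (smaller shorter)

  cycle : ∀ {v} → P v → Cycle R
  cycle {v} Pv with extend Pv v
  ... | w , Pw , Rwv , w≢v =
    walk w v [] vertices Pw ((w≢v ∷ []) ∷ [] ∷ []) (Rwv ∷ [-]) (λ x → inj₂ (complete x))
         (<-wellFounded _)

≢? : ∀ {n} (i : Fin n) → Decidable (_≢ i)
≢? i j = ¬? (j Fin.≟ i)

module _ {n d : ℕ} (C : Ty n d) where

  others : List (Fin n) → Fin n → List (Fin n)
  others J i = filter (≢? i) J

  others-shorter : ∀ {J i} → i ∈ˡ J → length (others J i) < length J
  others-shorter {J} {i} i∈J =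
    filter-notAll (≢? i) J (Any.map (λ i≡j j≢i → j≢i (sym i≡j)) i∈J)

  Covered : List (Fin n) → Fin d → Set
  Covered S x = Any (λ j → x ∈ lookup C j) S

  covered? : ∀ S → Decidable (Covered S)
  covered? S x = Any.any? (λ j → x ∈? lookup C j) S

  Shared : List (Fin n) → Fin n → Fin d → Set
  Shared J i x = x ∈ lookup C i × Covered (others J i) x

  Branching : List (Fin n) → Fin n → Set
  Branching J i = ∃₂ λ x y → x ≢ y × Shared J i x × Shared J i y

  branching? : ∀ J i → Dec (Branching J i)
  branching? J i = any? λ x → any? λ y → ¬? (x Fin.≟ y) ×-dec shared? x ×-dec shared? y
    where
    shared? : Decidable (Shared J i)
    shared? x = (x ∈? lookup C i) ×-dec covered? (others J i) x

  vertices : List (Vertex n d)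
  vertices = map inj₁ (allFin n) ++ map inj₂ (allFin d)

  vertices-complete : ∀ v → v ∈ˡ vertices
  vertices-complete (inj₁ i) = ∈-++⁺ˡ (∈-map⁺ inj₁ (∈-allFin i))
  vertices-complete (inj₂ x) = ∈-++⁺ʳ (map inj₁ (allFin n)) (∈-map⁺ inj₂ (∈-allFin x))

  -- K_C is bipartite, hence loopless
  adj-irreflexive : ∀ {v} → ¬ Adj C v v
  adj-irreflexive ()

  _≟V_ : DecidableEquality (Vertex n d)
  _≟V_ = ≡-dec Fin._≟_ Fin._≟_

  module BranchingWalk (J : List (Fin n)) (allBranching : ∀ {i} → i ∈ˡ J → Branching J i) where

    OnWalk : Vertex n d → Set
    OnWalk (inj₁ i) = i ∈ˡ J
    OnWalk (inj₂ x) = ∃₂ λ j k → j ≢ k × (j ∈ˡ J × x ∈ lookup C j) × (k ∈ˡ J × x ∈ lookup C k)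

    shared-onWalk : ∀ {i x} → i ∈ˡ J → Shared J i x → OnWalk (inj₂ x)
    shared-onWalk {i} i∈J (x∈Ci , covered) with find covered
    ... | j , j∈others , x∈Cj with ∈-filter⁻ (≢? i) j∈others
    ...   | j∈J , j≢i = i , j , (λ i≡j → j≢i (sym i≡j)) , (i∈J , x∈Ci) , (j∈J , x∈Cj)

    extend : ∀ {v} → OnWalk v → ∀ u → ∃ λ w → OnWalk w × Adj C w v × w ≢ u
    extend {inj₁ i} i∈J u with allBranching i∈J
    ... | x , y , x≢y , x-shared , y-shared with one-avoids _≟V_ (x≢y ∘ inj₂-injective) u
    ...   | inj₁ x≢u = inj₂ x , shared-onWalk i∈J x-shared , dn i x (proj₁ x-shared) , x≢u
    ...   | inj₂ y≢u = inj₂ y , shared-onWalk i∈J y-shared , dn i y (proj₁ y-shared) , y≢u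
    extend {inj₂ x} (j , k , j≢k , (j∈J , x∈Cj) , (k∈J , x∈Ck)) u
      with one-avoids _≟V_ (j≢k ∘ inj₁-injective) u
    ... | inj₁ j≢u = inj₁ j , j∈J , nd j x x∈Cj , j≢u
    ... | inj₂ k≢u = inj₁ k , k∈J , nd k x x∈Ck , k≢u

    open NonBacktrackingWalk _≟V_ vertices vertices-complete (Adj C) adj-irreflexive OnWalk extend
      public using (cycle)

  leaf-exists : Forest C → ∀ {J i₀} → i₀ ∈ˡ J → ∃ λ i → i ∈ˡ J × ¬ Branching J i
  leaf-exists forest {J} i₀∈J with All.all? (branching? J) J
  ... | yes allBranching =
    ⊥-elim (forest (BranchingWalk.cycle J (All.lookup allBranching) {inj₁ _} i₀∈J))
  ... | no notAll = find (¬All⇒Any¬ (branching? J) J notAll)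

  Targets : (Fin n → Subset d) → List (Fin n) → Set
  Targets T J = ∀ {j} → j ∈ˡ J → T j ⊆ lookup C j × Nonempty (T j)

  Realises : (Fin d → ℕ) → (Fin n → Subset d) → List (Fin n) → Set
  Realises r T J = ∀ {j} → j ∈ˡ J → ∀ x → Minimal r (lookup C j) x ⇔ x ∈ T j

  -- In a forest every choice of targets is realised by some rank function:
  -- realise the targets off a leaf i, then re-rank C_i.
  forest-realises : Forest C → ∀ T J → Targets T J → ∃ λ r → Realises r T J
  forest-realises forest T J targets = go J targets (<-wellFounded (length J))
    where
    go : ∀ J → Targets T J → Acc _<_ (length J) → ∃ λ r → Realises r T J
    go [] _ _ = (λ _ → 0) , λ ()
    go J@(_ ∷ _) targets (acc smaller) with leaf-exists forest {J} (here refl)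
    ... | i , i∈J , leaf
      with go (others J i) (targets ∘ proj₁ ∘ ∈-filter⁻ (≢? i)) (smaller (others-shorter i∈J))
    ...   | r , realised
      with rerank r (covered? (others J i)) (proj₁ (targets i∈J)) (proj₂ (targets i∈J)) atMostOne
      where
      atMostOne : ∀ {x y} → x ∈ lookup C i → Covered (others J i) x →
                  y ∈ lookup C i → Covered (others J i) y → x ≡ y
      atMostOne {x} {y} x∈Ci x-cov y∈Ci y-cov =
        decidable-stable (x Fin.≟ y) λ x≢y → leaf (x , y , x≢y , (x∈Ci , x-cov) , (y∈Ci , y-cov))
    ...     | r′ , shifted , realised-i = r′ , realised′
      where
      realised′ : Realises r′ T J
      realised′ {j} j∈J with j Fin.≟ i
      ... | yes refl = realised-i
      ... | no j≢i = λ x →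
        ⇔-trans (⇔-sym (minimal-shift (λ x∈Cj → shifted (lose j∈others x∈Cj)) x))
                (realised j∈others x)
        where
        j∈others : j ∈ˡ others J i
        j∈others = ∈-filter⁺ (≢? i) j∈J j≢i

refinements-realise : ∀ {n d} (C : Ty n d) → Forest C →
                      (I : Vec (Subset d) n) (A' : Subset n) →
                      (∀ i → i ∈ A' → T I C i ≡ zero) → (X : SignVec A') →
                      ∃ λ P → ∀ i (p : i ∈ A') → T I (refine P C) i ≡ X i p
refinements-realise {n} {d} C forest I A' zeros X = rankPartition , signs
  where
  choice : ∀ {i} (p : i ∈ A') →
           ∃ λ t → t ⊆ lookup C i × Nonempty t × sign t (lookup I i) ≡ X i p
  choice {i} p = subset-of-sign (zeros i p) (X i p)

  -- the targets as a total function; target-spec recovers the choice, as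
  -- membership proofs in A' are unique
  targetFor : ∀ i → Dec (i ∈ A') → Subset d
  targetFor i (yes p) = proj₁ (choice p)
  targetFor i (no _) = lookup C i

  target : Fin n → Subset d
  target i = targetFor i (i ∈? A')

  target-spec : ∀ {i} (p : i ∈ A') → target i ≡ proj₁ (choice p)
  target-spec {i} p rewrite dec-yes-irr (i ∈? A') []=-irrelevant p = refl

  J : List (Fin n)
  J = filter (_∈? A') (allFin n)

  targets : Targets C target J
  targets j∈J with p ← proj₂ (∈-filter⁻ (_∈? A') {xs = allFin n} j∈J) rewrite target-spec p =
    proj₁ (proj₂ (choice p)) , proj₁ (proj₂ (proj₂ (choice p)))

  ranks : ∃ λ r → Realises C r target J
  ranks = forest-realises C forest target J targets
  open RankPartition (proj₁ ranks)

  signs : ∀ i (p : i ∈ A') → T I (refine rankPartition C) i ≡ X i p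
  signs i p = begin
    sign (lookup (refine rankPartition C) i) (lookup I i)
      ≡⟨ cong (λ c → sign c (lookup I i)) (lookup-map i _ C) ⟩
    sign (refineEntry (OrderedPartition.blocks rankPartition) (lookup C i)) (lookup I i)
      ≡⟨ cong (λ c → sign c (lookup I i)) (refine-rankPartition Ci≠∅ (proj₂ ranks i∈J)) ⟩
    sign (target i) (lookup I i)
      ≡⟨ cong (λ c → sign c (lookup I i)) (target-spec p) ⟩
    sign (proj₁ (choice p)) (lookup I i)
      ≡⟨ proj₂ (proj₂ (proj₂ (choice p))) ⟩
    X i p ∎
    where
    open ≡-Reasoning
    i∈J : i ∈ˡ J
    i∈J = ∈-filter⁺ (_∈? A') (∈-allFin i) p
    Ci≠∅ : Nonempty (lookup C i)
    Ci≠∅ = let (_ , t⊆Ci , (x , x∈t) , _) = choice p in x , t⊆Ci x∈t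

isZero? : (s : Sign) → Dec (s ≡ zero)
isZero? plus = no λ ()
isZero? minus = no λ ()
isZero? zero = yes refl

zero-covector? : ∀ {n d} (M : List (Ty n d)) I (A' : Subset n) →
                 Dec (InL M I A' (zeroVec A'))
zero-covector? M I A' =
  map′ find (λ (C , C∈M , zeros) → lose C∈M zeros)
       (Any.any? (λ C → all? λ i → (i ∈? A') →-dec isZero? (T I C i)) M)

-- Either 0 ∉ L, or some C ∈ M has T_I(C) = 0 and its refinements, which
-- lie in M by Surrounding, realise every sign vector.
proposition5p6 : (n d : ℕ) (M : List (Ty n d)) → IsTOM n d M → GeneralPosition M →
    (I : Vec (Subset d) n) → IsHalfspaceSystem I → (A' : Subset n) →
    ¬ InL M I A' (zeroVec A') ⊎ (∀ (X : SignVec A') → InL M I A' X)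
proposition5p6 n d M tom generalPosition I _ A' with zero-covector? M I A'
... | no noZero = inj₁ noZero
... | yes (C , C∈M , zeros) = inj₂ λ X →
  let (P , signs) = refinements-realise C (generalPosition C C∈M) I A' zeros X
  in refine P C , IsTOM.surrounding tom C C∈M P , signs
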